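{- Let $\mathbf{A}=\langle A,\oplus,{}^*,0,\diamond,i\rangle$ be a CMV-algebra and $I\subseteq A$. Then $I$ is a CMV-ideal of $\mathbf{A}$ if and only if the relation $\sim_I$ is a congruence of the CMV-algebra $\mathbf{A}$ (i.e. an equivalence relation compatible with $\oplus$, ${}^*$ and $\diamond$).
   Context: A CMV-algebra is a structure $\langle A,\oplus,{}^*,0,\diamond,i\rangle$ such that $\langle A,\oplus,{}^*,0\rangle$ is an MV-algebra, $\langle A,\diamond,i\rangle$ is a monoid, and for all $x,y,z$: $(y\oplus z)\diamond x=(y\diamond x)\oplus(z\diamond x)$, $x^*\diamond y=(x\diamond y)^*$, $0\diamond x=0$. Put $1=0^*$, $x\odot y=(x^*\oplus y^*)^*$, and $x\le y$ iff $x^*\oplus y=1$. For $I\subseteq A$, $x\sim_I y$ means $(x\odot y^*)\oplus(y\odot x^*)\in I$. A CMV-ideal is a non-empty subset $I\subseteq A$ such that: (i) $x\in I$, $y\le x$ imply $y\in I$; (ii) $x,y\in I$ imply $x\oplus y\in I$; (iii) $x\diamond y\in I$ for all $x\in I$, $y\in A$; (iv) for all $a,x,y\in A$, $x\sim_I y$ implies $a\diamond x\sim_I a\diamond y$. -}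

module Defs where

open import Level using (Level; _⊔_; suc)
open import Relation.Binary.PropositionalEquality using (_≡_)
open import Data.Product using (Σ; _×_)

record IsMV {a} (A : Set a) (_⊕_ : A → A → A) (_* : A → A) (0# : A) : Set a where
  field
    ⊕-assoc : ∀ x y z → (x ⊕ y) ⊕ z ≡ x ⊕ (y ⊕ z)
    ⊕-comm  : ∀ x y → x ⊕ y ≡ y ⊕ x
    ⊕-idʳ   : ∀ x → x ⊕ 0# ≡ x
    **-inv  : ∀ x → (x *) * ≡ x
    ⊕-absorb : ∀ x → x ⊕ (0# *) ≡ 0# *
    luk     : ∀ x y → (((x *) ⊕ y) *) ⊕ y ≡ (((y *) ⊕ x) *) ⊕ x

record CMVAlgebra a : Set (suc a) where
  infixl 6 _⊕_
  infixl 7 _⋄_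
  field
    Carrier : Set a
    _⊕_ : Carrier → Carrier → Carrier
    _* : Carrier → Carrier
    0# : Carrier
    _⋄_ : Carrier → Carrier → Carrier
    i : Carrier
    isMV : IsMV Carrier _⊕_ _* 0#
    ⋄-assoc : ∀ x y z → (x ⋄ y) ⋄ z ≡ x ⋄ (y ⋄ z)
    ⋄-idˡ : ∀ x → i ⋄ x ≡ x
    ⋄-idʳ : ∀ x → x ⋄ i ≡ x
    ⋄-distrib : ∀ x y z → (y ⊕ z) ⋄ x ≡ (y ⋄ x) ⊕ (z ⋄ x)
    *-⋄ : ∀ x y → (x *) ⋄ y ≡ (x ⋄ y) *
    0-⋄ : ∀ x → 0# ⋄ x ≡ 0#

  1# : Carrier
  1# = 0# *

  _⊙_ : Carrier → Carrier → Carrier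
  x ⊙ y = ((x *) ⊕ (y *)) *

  _≤_ : Carrier → Carrier → Set a
  x ≤ y = (x *) ⊕ y ≡ 1#

  ∼[_] : ∀ {ℓ} → (Carrier → Set ℓ) → Carrier → Carrier → Set ℓ
  ∼[ I ] x y = I ((x ⊙ (y *)) ⊕ (y ⊙ (x *)))

  record IsCMVIdeal {ℓ} (I : Carrier → Set ℓ) : Set (a ⊔ ℓ) where
    field
      nonempty : Σ Carrier I
      downward : ∀ {x y} → I x → y ≤ x → I y
      ⊕-closed : ∀ {x y} → I x → I y → I (x ⊕ y)
      ⋄-closed : ∀ {x} → I x → ∀ y → I (x ⋄ y)
      ∼-⋄-compat : ∀ a x y → ∼[ I ] x y → ∼[ I ] (a ⋄ x) (a ⋄ y)

  record IsCMVCongruence {ℓ} (R : Carrier → Carrier → Set ℓ) : Set (a ⊔ ℓ) where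
    field
      refl  : ∀ x → R x x
      sym   : ∀ {x y} → R x y → R y x
      trans : ∀ {x y z} → R x y → R y z → R x z
      ⊕-compat : ∀ {x x' y y'} → R x x' → R y y' → R (x ⊕ y) (x' ⊕ y')
      *-compat : ∀ {x x'} → R x x' → R (x *) (x' *)
      ⋄-compat : ∀ {x x' y y'} → R x x' → R y y' → R (x ⋄ y) (x' ⋄ y')

module Submission where

-- Everything is phrased through the truncated difference x ⊖ y = x ⊙ y* and the
-- distance d(x,y) = (x ⊖ y) ⊕ (y ⊖ x), so that x ∼_I y just says d(x,y) ∈ I.  Then the one CMV fact
-- needed: right ⋄-multiplication commutes with ⊖.
-- (⇒) An ideal is downward closed and ⊕-closed, so the inequalities above make
--     ∼_I reflexive, symmetric, transitive and compatible with ⊕ and *; ⋄ is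
--     handled on the left by ⋄-closure and on the right by axiom (iv).
-- (⇐) Since x ∈ I ⇔ x ∼_I 0, the ideal axioms are the congruence laws at 0;
--     downward closure uses y = x ⊖ (x ⊖ y) ∼_I 0 ⊖ (x ⊖ y) = 0.

open import Defs
import Level
open import Data.Product using (_×_; Σ; _,_; proj₁; proj₂)
open import Relation.Binary.PropositionalEquality as P using (_≡_; cong; cong₂; subst; subst₂)
open P.≡-Reasoning

-- An MV-algebra bundled with its operations, so that the operators carry fixities.
record MVAlgebra a : Set (Level.suc a) where
  infixl 6 _⊕_
  field
    Carrier : Set a
    _⊕_ : Carrier → Carrier → Carrier
    _* : Carrier → Carrier
    0# : Carrier
    isMV : IsMV Carrier _⊕_ _* 0#

  open IsMV isMV public

  1# : Carrier
  1# = 0# *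

  _≤_ : Carrier → Carrier → Set a
  x ≤ y = x * ⊕ y ≡ 1#

mvReduct : ∀ {a} → CMVAlgebra a → MVAlgebra a
mvReduct 𝔸 = record { CMVAlgebra 𝔸 }

module MVProperties {a} (M : MVAlgebra a) where
  open MVAlgebra M

  infixl 7 _⊖_
  infix 4 _≼_

  ⊕-idˡ : ∀ x → 0# ⊕ x ≡ x
  ⊕-idˡ x = P.trans (⊕-comm 0# x) (⊕-idʳ x)

  ⊕-zeroˡ : ∀ x → 1# ⊕ x ≡ 1#
  ⊕-zeroˡ x = P.trans (⊕-comm 1# x) (⊕-absorb x)

  1*≡0 : 1# * ≡ 0#
  1*≡0 = **-inv 0#

  -- x* ⊕ x = 1, obtained from Łukasiewicz's axiom with y = 1.
  complementˡ : ∀ x → x * ⊕ x ≡ 1#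
  complementˡ x = begin
    x * ⊕ x                ≡⟨ cong (λ t → t * ⊕ x) (P.sym (⊕-idˡ x)) ⟩
    (0# ⊕ x) * ⊕ x         ≡⟨ cong (λ t → (t ⊕ x) * ⊕ x) (P.sym 1*≡0) ⟩
    (1# * ⊕ x) * ⊕ x       ≡⟨ P.sym (luk x 1#) ⟩
    (x * ⊕ 1#) * ⊕ 1#      ≡⟨ ⊕-absorb _ ⟩
    1#                     ∎

  ⊕-interchange : ∀ p q r s → (p ⊕ q) ⊕ (r ⊕ s) ≡ (p ⊕ r) ⊕ (q ⊕ s)
  ⊕-interchange p q r s = begin
    (p ⊕ q) ⊕ (r ⊕ s)  ≡⟨ ⊕-assoc _ _ _ ⟩
    p ⊕ (q ⊕ (r ⊕ s))  ≡⟨ cong (p ⊕_) (P.sym (⊕-assoc _ _ _)) ⟩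
    p ⊕ ((q ⊕ r) ⊕ s)  ≡⟨ cong (λ t → p ⊕ (t ⊕ s)) (⊕-comm q r) ⟩
    p ⊕ ((r ⊕ q) ⊕ s)  ≡⟨ cong (p ⊕_) (⊕-assoc _ _ _) ⟩
    p ⊕ (r ⊕ (q ⊕ s))  ≡⟨ P.sym (⊕-assoc _ _ _) ⟩
    (p ⊕ r) ⊕ (q ⊕ s)  ∎

  -- Algebraic order; it implies the order ≤ of the paper, and is easier to
  -- manipulate because it carries an explicit witness.
  _≼_ : Carrier → Carrier → Set a
  x ≼ y = Σ Carrier (λ z → x ⊕ z ≡ y)

  ≼⇒≤ : ∀ {x y} → x ≼ y → x ≤ y
  ≼⇒≤ {x} (z , P.refl) = begin
    x * ⊕ (x ⊕ z)  ≡⟨ P.sym (⊕-assoc _ _ _) ⟩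
    (x * ⊕ x) ⊕ z  ≡⟨ cong (_⊕ z) (complementˡ x) ⟩
    1# ⊕ z         ≡⟨ ⊕-zeroˡ z ⟩
    1#             ∎

  ≼-trans : ∀ {x y z} → x ≼ y → y ≼ z → x ≼ z
  ≼-trans {x} (u , P.refl) (v , P.refl) = u ⊕ v , P.sym (⊕-assoc x u v)

  ≼-respʳ-≡ : ∀ {x y z} → x ≼ y → y ≡ z → x ≼ z
  ≼-respʳ-≡ p P.refl = p

  ⊕-monoʳ-≼ : ∀ w {x y} → x ≼ y → w ⊕ x ≼ w ⊕ y
  ⊕-monoʳ-≼ w {x} (u , P.refl) = u , ⊕-assoc w x u

  ⊕-monoˡ-≼ : ∀ w {x y} → x ≼ y → x ⊕ w ≼ y ⊕ w
  ⊕-monoˡ-≼ w {x} {y} p =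
    subst₂ _≼_ (⊕-comm w x) (⊕-comm w y) (⊕-monoʳ-≼ w p)

  _⊖_ : Carrier → Carrier → Carrier
  x ⊖ y = (x * ⊕ y) *

  d : Carrier → Carrier → Carrier
  d x y = x ⊖ y ⊕ y ⊖ x

  -- x ≤ (x ⊖ y) ⊕ y: this is Łukasiewicz's axiom read as x ∨ y = (x ⊖ y) ⊕ y.
  ≼-⊖-⊕ : ∀ x y → x ≼ x ⊖ y ⊕ y
  ≼-⊖-⊕ x y = y ⊖ x , P.trans (⊕-comm _ _) (luk y x)

  ⊖-residual : ∀ x y z → x ≼ y ⊕ z → x ⊖ y ≼ z
  ⊖-residual x y z p = z ⊖ (x ⊖ y) , P.trans (⊕-comm _ _) (P.trans (luk z (x ⊖ y)) join)
    where
    join : ((x ⊖ y) * ⊕ z) * ⊕ z ≡ z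
    join = begin
      ((x ⊖ y) * ⊕ z) * ⊕ z   ≡⟨ cong (λ t → (t ⊕ z) * ⊕ z) (**-inv _) ⟩
      ((x * ⊕ y) ⊕ z) * ⊕ z   ≡⟨ cong (λ t → t * ⊕ z) (⊕-assoc _ _ _) ⟩
      (x * ⊕ (y ⊕ z)) * ⊕ z   ≡⟨ cong (λ t → t * ⊕ z) (≼⇒≤ p) ⟩
      1# * ⊕ z                ≡⟨ cong (_⊕ z) 1*≡0 ⟩
      0# ⊕ z                  ≡⟨ ⊕-idˡ z ⟩
      z                       ∎

  ⊖-triangle : ∀ x y z → x ⊖ z ≼ x ⊖ y ⊕ y ⊖ z
  ⊖-triangle x y z = ⊖-residual x z _ (≼-respʳ-≡ chain regroup)
    where
    chain : x ≼ x ⊖ y ⊕ (y ⊖ z ⊕ z)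
    chain = ≼-trans (≼-⊖-⊕ x y) (⊕-monoʳ-≼ (x ⊖ y) (≼-⊖-⊕ y z))
    regroup : x ⊖ y ⊕ (y ⊖ z ⊕ z) ≡ z ⊕ (x ⊖ y ⊕ y ⊖ z)
    regroup = P.trans (P.sym (⊕-assoc _ _ _)) (⊕-comm _ _)

  ⊖-⊕-subadditive : ∀ x y x' y' → (x ⊕ y) ⊖ (x' ⊕ y') ≼ x ⊖ x' ⊕ y ⊖ y'
  ⊖-⊕-subadditive x y x' y' = ⊖-residual _ _ _ (≼-respʳ-≡ chain regroup)
    where
    chain : x ⊕ y ≼ (x ⊖ x' ⊕ x') ⊕ (y ⊖ y' ⊕ y')
    chain = ≼-trans (⊕-monoˡ-≼ y (≼-⊖-⊕ x x')) (⊕-monoʳ-≼ _ (≼-⊖-⊕ y y'))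
    regroup : (x ⊖ x' ⊕ x') ⊕ (y ⊖ y' ⊕ y') ≡ (x' ⊕ y') ⊕ (x ⊖ x' ⊕ y ⊖ y')
    regroup = P.trans (⊕-interchange _ _ _ _) (⊕-comm _ _)

  ⊖-* : ∀ x y → x * ⊖ y * ≡ y ⊖ x
  ⊖-* x y = cong _* (P.trans (cong (_⊕ y *) (**-inv x)) (⊕-comm _ _))

  ⊖-self : ∀ x → x ⊖ x ≡ 0#
  ⊖-self x = P.trans (cong _* (complementˡ x)) 1*≡0

  ⊖-zeroˡ : ∀ x → 0# ⊖ x ≡ 0#
  ⊖-zeroˡ x = P.trans (cong _* (⊕-zeroˡ x)) 1*≡0

  ⊖-idʳ : ∀ x → x ⊖ 0# ≡ x
  ⊖-idʳ x = P.trans (cong _* (⊕-idʳ _)) (**-inv x)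

  d-0 : ∀ x → d x 0# ≡ x
  d-0 x = begin
    x ⊖ 0# ⊕ 0# ⊖ x  ≡⟨ cong₂ _⊕_ (⊖-idʳ x) (⊖-zeroˡ x) ⟩
    x ⊕ 0#           ≡⟨ ⊕-idʳ x ⟩
    x                ∎

  -- Below x, the map y ↦ x ⊖ y is an involution: y = x ∧ y = x ⊖ (x ⊖ y).
  ≤⇒⊖-involutive : ∀ {x y} → y ≤ x → x ⊖ (x ⊖ y) ≡ y
  ≤⇒⊖-involutive {x} {y} y≤x = P.trans (cong _* (P.sym y*-decomposition)) (**-inv y)
    where
    y*-decomposition : y * ≡ x * ⊕ x ⊖ y
    y*-decomposition = begin
      y *                          ≡⟨ P.sym (⊕-idˡ _) ⟩
      0# ⊕ y *                     ≡⟨ cong (_⊕ y *) (P.sym 1*≡0) ⟩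
      1# * ⊕ y *                   ≡⟨ cong (λ t → t * ⊕ y *) (P.sym y≤x) ⟩
      (y * ⊕ x) * ⊕ y *            ≡⟨ cong (λ t → (y * ⊕ t) * ⊕ y *) (P.sym (**-inv x)) ⟩
      (y * ⊕ x * *) * ⊕ y *        ≡⟨ cong (λ t → t * ⊕ y *) (⊕-comm _ _) ⟩
      (x * * ⊕ y *) * ⊕ y *        ≡⟨ P.sym (luk (y *) (x *)) ⟩
      (y * * ⊕ x *) * ⊕ x *        ≡⟨ cong (λ t → (t ⊕ x *) * ⊕ x *) (**-inv y) ⟩
      (y ⊕ x *) * ⊕ x *            ≡⟨ cong (λ t → t * ⊕ x *) (⊕-comm _ _) ⟩
      x ⊖ y ⊕ x *                  ≡⟨ ⊕-comm _ _ ⟩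
      x * ⊕ x ⊖ y                  ∎

module CMVProperties {a} (𝔸 : CMVAlgebra a) where
  open CMVAlgebra 𝔸
  open IsMV isMV using (**-inv; ⊕-idʳ; ⊕-comm)
  open MVProperties (mvReduct 𝔸)

  -- Right multiplication by z is an MV-endomorphism, so it commutes with ⊖.
  ⊖-⋄ : ∀ x y z → (x ⊖ y) ⋄ z ≡ (x ⋄ z) ⊖ (y ⋄ z)
  ⊖-⋄ x y z = begin
    (x * ⊕ y) * ⋄ z          ≡⟨ *-⋄ _ _ ⟩
    ((x * ⊕ y) ⋄ z) *        ≡⟨ cong _* (⋄-distrib _ _ _) ⟩
    (x * ⋄ z ⊕ y ⋄ z) *      ≡⟨ cong (λ t → (t ⊕ y ⋄ z) *) (*-⋄ _ _) ⟩
    ((x ⋄ z) * ⊕ y ⋄ z) *    ∎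

  module _ {ℓ} (I : Carrier → Set ℓ) where

    ∼-term≡d : ∀ x y → (x ⊙ (y *)) ⊕ (y ⊙ (x *)) ≡ d x y
    ∼-term≡d x y =
      cong₂ _⊕_ (cong (λ t → (x * ⊕ t) *) (**-inv y)) (cong (λ t → (y * ⊕ t) *) (**-inv x))

    ∼⇒d∈ : ∀ {x y} → ∼[ I ] x y → I (d x y)
    ∼⇒d∈ {x} {y} = subst I (∼-term≡d x y)

    d∈⇒∼ : ∀ {x y} → I (d x y) → ∼[ I ] x y
    d∈⇒∼ {x} {y} = subst I (P.sym (∼-term≡d x y))

    ∈⇒∼0 : ∀ {x} → I x → ∼[ I ] x 0#
    ∈⇒∼0 {x} x∈I = d∈⇒∼ (subst I (P.sym (d-0 x)) x∈I)

    ∼0⇒∈ : ∀ {x} → ∼[ I ] x 0# → I x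
    ∼0⇒∈ {x} x∼0 = subst I (d-0 x) (∼⇒d∈ x∼0)

  module IdealToCongruence {ℓ} {I : Carrier → Set ℓ} (ideal : IsCMVIdeal I) where
    open IsCMVIdeal ideal

    ≼-closed : ∀ {x y} → I x → y ≼ x → I y
    ≼-closed x∈I y≼x = downward x∈I (≼⇒≤ y≼x)

    0∈I : I 0#
    0∈I = ≼-closed (proj₂ nonempty) (proj₁ nonempty , ⊕-idˡ _)

    ∼⇒⊖∈ : ∀ {x y} → ∼[ I ] x y → I (x ⊖ y)
    ∼⇒⊖∈ x∼y = ≼-closed (∼⇒d∈ I x∼y) (_ , P.refl)

    ∼⇒⊖∈′ : ∀ {x y} → ∼[ I ] x y → I (y ⊖ x)
    ∼⇒⊖∈′ x∼y = ≼-closed (∼⇒d∈ I x∼y) (_ , ⊕-comm _ _)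

    ⊖∈⇒∼ : ∀ {x y} → I (x ⊖ y) → I (y ⊖ x) → ∼[ I ] x y
    ⊖∈⇒∼ p q = d∈⇒∼ I (⊕-closed p q)

    ⊖∈-trans : ∀ {x y z} → I (x ⊖ y) → I (y ⊖ z) → I (x ⊖ z)
    ⊖∈-trans p q = ≼-closed (⊕-closed p q) (⊖-triangle _ _ _)

    ⊖∈-⊕ : ∀ {x y x' y'} → I (x ⊖ x') → I (y ⊖ y') → I ((x ⊕ y) ⊖ (x' ⊕ y'))
    ⊖∈-⊕ p q = ≼-closed (⊕-closed p q) (⊖-⊕-subadditive _ _ _ _)

    ⊖∈-⋄ʳ : ∀ {x x'} → I (x ⊖ x') → ∀ y → I ((x ⋄ y) ⊖ (x' ⋄ y))
    ⊖∈-⋄ʳ p y = subst I (⊖-⋄ _ _ y) (⋄-closed p y)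

    ⊖∈-* : ∀ {x x'} → I (x' ⊖ x) → I (x * ⊖ x' *)
    ⊖∈-* p = subst I (P.sym (⊖-* _ _)) p

    congruence : IsCMVCongruence (∼[ I ])
    congruence = record
      { refl     = λ x → d∈⇒∼ I (subst I (P.sym (d-self x)) 0∈I)
      ; sym      = λ r → ⊖∈⇒∼ (∼⇒⊖∈′ r) (∼⇒⊖∈ r)
      ; trans    = λ r s → ⊖∈⇒∼ (⊖∈-trans (∼⇒⊖∈ r) (∼⇒⊖∈ s)) (⊖∈-trans (∼⇒⊖∈′ s) (∼⇒⊖∈′ r))
      ; ⊕-compat = λ r s → ⊖∈⇒∼ (⊖∈-⊕ (∼⇒⊖∈ r) (∼⇒⊖∈ s)) (⊖∈-⊕ (∼⇒⊖∈′ r) (∼⇒⊖∈′ s))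
      ; *-compat = λ r → ⊖∈⇒∼ (⊖∈-* (∼⇒⊖∈′ r)) (⊖∈-* (∼⇒⊖∈ r))
      ; ⋄-compat = ⋄-compat
      }
      where
      d-self : ∀ x → d x x ≡ 0#
      d-self x = P.trans (cong₂ _⊕_ (⊖-self x) (⊖-self x)) (⊕-idʳ 0#)

      -- x ⋄ y ∼ x' ⋄ y by ⋄-closure, and x' ⋄ y ∼ x' ⋄ y' by axiom (iv).
      ⋄-compat : ∀ {x x' y y'} → ∼[ I ] x x' → ∼[ I ] y y' → ∼[ I ] (x ⋄ y) (x' ⋄ y')
      ⋄-compat {x} {x'} {y} {y'} r s =
        ⊖∈⇒∼ (⊖∈-trans (⊖∈-⋄ʳ (∼⇒⊖∈ r) y) (∼⇒⊖∈ s'))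
             (⊖∈-trans (∼⇒⊖∈′ s') (⊖∈-⋄ʳ (∼⇒⊖∈′ r) y))
        where
        s' : ∼[ I ] (x' ⋄ y) (x' ⋄ y')
        s' = ∼-⋄-compat x' y y' s

  module CongruenceToIdeal {ℓ} {I : Carrier → Set ℓ} (cong∼ : IsCMVCongruence (∼[ I ])) where
    open IsCMVCongruence cong∼

    ⊖-compat : ∀ {x x' y y'} → ∼[ I ] x x' → ∼[ I ] y y' → ∼[ I ] (x ⊖ y) (x' ⊖ y')
    ⊖-compat r s = *-compat (⊕-compat (*-compat r) s)

    -- y ≤ x ∈ I:  y = x ⊖ (x ⊖ y) ∼_I 0 ⊖ (x ⊖ y) = 0.
    downward-closed : ∀ {x y} → I x → y ≤ x → I y
    downward-closed {x} {y} x∈I y≤x =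
      ∼0⇒∈ I (subst₂ (∼[ I ]) (≤⇒⊖-involutive y≤x) (⊖-zeroˡ _) x⊖[x⊖y]∼0⊖[x⊖y])
      where
      x⊖[x⊖y]∼0⊖[x⊖y] : ∼[ I ] (x ⊖ (x ⊖ y)) (0# ⊖ (x ⊖ y))
      x⊖[x⊖y]∼0⊖[x⊖y] = ⊖-compat (∈⇒∼0 I x∈I) (refl (x ⊖ y))

    ideal : IsCMVIdeal I
    ideal = record
      { nonempty   = _ , refl 0#
      ; downward   = downward-closed
      ; ⊕-closed   = λ x∈I y∈I →
          ∼0⇒∈ I (subst (∼[ I ] _) (⊕-idʳ 0#) (⊕-compat (∈⇒∼0 I x∈I) (∈⇒∼0 I y∈I)))
      ; ⋄-closed   = λ x∈I y →
          ∼0⇒∈ I (subst (∼[ I ] _) (0-⋄ y) (⋄-compat (∈⇒∼0 I x∈I) (refl y)))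
      ; ∼-⋄-compat = λ a x y x∼y → ⋄-compat (refl a) x∼y
      }

mainTheorem8 : ∀ {a ℓ} (𝔸 : CMVAlgebra a) (I : CMVAlgebra.Carrier 𝔸 → Set ℓ) →
    (CMVAlgebra.IsCMVIdeal 𝔸 I → CMVAlgebra.IsCMVCongruence 𝔸 (CMVAlgebra.∼[_] 𝔸 I))
    × (CMVAlgebra.IsCMVCongruence 𝔸 (CMVAlgebra.∼[_] 𝔸 I) → CMVAlgebra.IsCMVIdeal 𝔸 I)
mainTheorem8 𝔸 I = IdealToCongruence.congruence , CongruenceToIdeal.ideal
  where open CMVProperties 𝔸
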